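{- Let $m\ge1$ and $n\geq 2m+1$ be integers, write $n=c(2m+1)+r$ with $0\le r<2m+1$, let $\mu=\gcd(2m+1,r)$ and $l_2=(2m+1)/\mu$. Then for the web graph $W_n^m$, $$\gamma_{\times l_2}(W_n^m)=\frac{n}{\mu}.$$
   Context: Web graph: $W_n^m$ has vertex set $\{v_1,\dots,v_n\}$ and $v_iv_j$ is an edge iff $j\equiv i\pm l\pmod n$ for some $l\in\{1,\dots,m\}$. $N[v]$ is the closed neighborhood. A set $D$ is a $k$-tuple dominating set if $|N[v]\cap D|\geq k$ for every vertex $v$; $\gamma_{\times k}(G)$ is the minimum cardinality of such a set. $\gcd(a,0)=a$. -}

module Defs where

open import Data.Nat using (ℕ; zero; suc; _+_; _*_; _≤_; _≡ᵇ_; NonZero; ≢-nonZero)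
open import Data.Nat.DivMod using (_%_; _/_)
open import Data.Nat.GCD using (gcd; gcd[m,n]≢0)
open import Data.Bool using (Bool; _∨_)
open import Data.Sum using (inj₁)
open import Data.List using (map; upTo)
open import Data.Bool.ListAction using (any)
open import Data.Fin using (Fin; toℕ)
open import Data.Fin.Subset using (Subset; _∩_; ∣_∣)
open import Data.Vec using (tabulate)

modEqᵇ : ℕ → ℕ → ℕ → Bool
modEqᵇ zero    a b = a ≡ᵇ b
modEqᵇ (suc k) a b = (a % suc k) ≡ᵇ (b % suc k)

-- Adjacency in the web graph W_n^m on vertices v_0..v_{n-1} (Fin n):
-- v_i v_j is an edge iff j ≡ i + l or j ≡ i - l (mod n) for some l ∈ {1,…,m}.
-- (j ≡ i - l  is written as  j + l ≡ i.)
webAdjᵇ : (n m : ℕ) → Fin n → Fin n → Bool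
webAdjᵇ n m i j =
  any (λ l → modEqᵇ n (toℕ j) (toℕ i + l) ∨ modEqᵇ n (toℕ j + l) (toℕ i))
      (map suc (upTo m))

closedNbhd : (n m : ℕ) → Fin n → Subset n
closedNbhd n m i = tabulate (λ j → (toℕ i ≡ᵇ toℕ j) ∨ webAdjᵇ n m i j)

IsKTupleDominating : (n m k : ℕ) → Subset n → Set
IsKTupleDominating n m k D = ∀ (v : Fin n) → k ≤ ∣ closedNbhd n m v ∩ D ∣

KTupleDominationNumberIs : (n m k g : ℕ) → Set
KTupleDominationNumberIs n m k g =
  (Σ (Subset n) λ D → IsKTupleDominating n m k D × ∣ D ∣ ≡ g)
  × (∀ (D : Subset n) → IsKTupleDominating n m k D → g ≤ ∣ D ∣)
  where
  open import Data.Product using (Σ; _×_)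
  open import Relation.Binary.PropositionalEquality using (_≡_)

μ : (n m : ℕ) → ℕ
μ n m = gcd (suc (2 * m)) (n % suc (2 * m))

μ-nonZero : ∀ n m → NonZero (μ n m)
μ-nonZero n m = ≢-nonZero (gcd[m,n]≢0 (suc (2 * m)) (n % suc (2 * m)) (inj₁ λ ()))

l₂ : (n m : ℕ) → ℕ
l₂ n m = _/_ (suc (2 * m)) (μ n m) {{μ-nonZero n m}}

-- Lower bound by double counting: every vertex lies in at most 2m+1 closed
-- neighbourhoods, so summing |N[v] ∩ D| ≥ l₂ over the n vertices gives
-- n·l₂ ≤ (2m+1)|D|, i.e. |D| ≥ n/μ.  Upper bound: μ divides 2m+1 and r, hence n,
-- so the multiples of μ form a set of size n/μ; every closed neighbourhood
-- contains the 2m+1 consecutive vertices v−m, …, v+m, among which exactly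
-- (2m+1)/μ are multiples of μ.

module Submission where

open import Defs
open import Data.Nat using (ℕ; zero; suc; _+_; _*_; _∸_; _≤_; _<_; _≡ᵇ_; z≤n; s≤s; z<s; NonZero; >-nonZero⁻¹)
open import Data.Nat.Properties
open import Data.Nat.DivMod
open import Data.Nat.Divisibility using (_∣_; ∣-refl; ∣n∣m%n⇒∣m)
open import Data.Nat.GCD using (gcd[m,n]∣m; gcd[m,n]∣n)
open import Algebra.Properties.CommutativeSemigroup +-commutativeSemigroup using (interchange)
open import Data.Bool using (Bool; true; false; _∧_; _∨_; T)
open import Data.Bool.Properties using (T-∨)
open import Data.Bool.ListAction using (any)
open import Data.List using (applyUpTo; map; upTo)
open import Data.List.Properties using (map-upTo)
open import Data.List.Membership.Propositional using (lose)
open import Data.List.Membership.Propositional.Properties using (∈-applyUpTo⁺)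
open import Data.List.Relation.Unary.Any.Properties using (any⁺)
open import Data.Fin using (Fin; toℕ; fromℕ<) renaming (zero to fzero; suc to fsuc)
open import Data.Fin.Properties using (toℕ-fromℕ<; toℕ-injective; toℕ<n)
open import Data.Fin.Subset using (Subset; _∩_; ∣_∣)
open import Data.Vec using (_∷_; []; lookup; tabulate)
open import Data.Vec.Properties using (lookup∘tabulate; lookup-zipWith)
open import Data.Product using (_,_; _×_; ∃-syntax)
open import Data.Sum using (_⊎_; inj₁; inj₂)
import Data.Sum
open import Function using (_∘_; Equivalence)
open import Relation.Binary.Definitions using (tri<; tri≈; tri>)
open import Relation.Binary.PropositionalEquality

∑ : ℕ → (ℕ → ℕ) → ℕ
∑ zero    f = 0
∑ (suc n) f = f 0 + ∑ n (f ∘ suc)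

syntax ∑ n (λ i → e) = ∑[ i < n ] e

𝟙 : Bool → ℕ
𝟙 true  = 1
𝟙 false = 0

∑-cong : ∀ n {f g : ℕ → ℕ} → (∀ i → i < n → f i ≡ g i) → ∑ n f ≡ ∑ n g
∑-cong zero    eq = refl
∑-cong (suc n) eq = cong₂ _+_ (eq 0 (s≤s z≤n)) (∑-cong n (λ i i<n → eq (suc i) (s≤s i<n)))

∑-mono-≤ : ∀ n {f g : ℕ → ℕ} → (∀ i → f i ≤ g i) → ∑ n f ≤ ∑ n g
∑-mono-≤ zero    le = z≤n
∑-mono-≤ (suc n) le = +-mono-≤ (le 0) (∑-mono-≤ n (le ∘ suc))

∑-const : ∀ n c → ∑[ i < n ] c ≡ n * c
∑-const zero    c = refl
∑-const (suc n) c = cong (c +_) (∑-const n c)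

∑-distrib-+ : ∀ n (f g : ℕ → ℕ) → ∑[ i < n ] (f i + g i) ≡ ∑ n f + ∑ n g
∑-distrib-+ zero    f g = refl
∑-distrib-+ (suc n) f g =
  trans (cong (f 0 + g 0 +_) (∑-distrib-+ n (f ∘ suc) (g ∘ suc)))
        (interchange (f 0) (g 0) _ _)

∑-distribʳ-* : ∀ n (f : ℕ → ℕ) c → ∑ n f * c ≡ ∑[ i < n ] (f i * c)
∑-distribʳ-* zero    f c = refl
∑-distribʳ-* (suc n) f c =
  trans (*-distribʳ-+ c (f 0) _) (cong (f 0 * c +_) (∑-distribʳ-* n (f ∘ suc) c))

∑-distribˡ-* : ∀ n c (f : ℕ → ℕ) → c * ∑ n f ≡ ∑[ i < n ] (c * f i)
∑-distribˡ-* zero    c f = *-zeroʳ c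
∑-distribˡ-* (suc n) c f =
  trans (*-distribˡ-+ c (f 0) _) (cong (c * f 0 +_) (∑-distribˡ-* n c (f ∘ suc)))

∑-comm : ∀ m n (f : ℕ → ℕ → ℕ) → ∑[ i < m ] ∑[ j < n ] f i j ≡ ∑[ j < n ] ∑[ i < m ] f i j
∑-comm m zero    f = trans (∑-const m 0) (*-zeroʳ m)
∑-comm m (suc n) f =
  trans (∑-distrib-+ m (λ i → f i 0) _) (cong (∑[ i < m ] f i 0 +_) (∑-comm m n (λ i → f i ∘ suc)))

∑-+ : ∀ m n f → ∑ (m + n) f ≡ ∑ m f + ∑[ i < n ] f (m + i)
∑-+ zero    n f = refl
∑-+ (suc m) n f = trans (cong (f 0 +_) (∑-+ m n (f ∘ suc))) (sym (+-assoc (f 0) _ _))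

∑-init-last : ∀ n f → ∑ (suc n) f ≡ ∑ n f + f n
∑-init-last zero    f = +-identityʳ (f 0)
∑-init-last (suc n) f = trans (cong (f 0 +_) (∑-init-last n (f ∘ suc))) (sym (+-assoc (f 0) _ _))

∑-shift : ∀ p (g : ℕ → ℕ) → (∀ x → g (x + p) ≡ g x) → ∀ s → ∑[ t < p ] g (s + t) ≡ ∑ p g
∑-shift p g periodic zero    = refl
∑-shift p g periodic (suc s) = trans rotate (∑-shift p g periodic s)
  where
  h : ℕ → ℕ
  h t = g (s + t)
  rotate : ∑[ t < p ] g (suc s + t) ≡ ∑ p h
  rotate = +-cancelʳ-≡ (h 0) _ _ (begin
    ∑[ t < p ] g (suc s + t) + h 0 ≡⟨ cong (_+ h 0) (∑-cong p (λ t _ → cong g (sym (+-suc s t)))) ⟩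
    ∑ p (h ∘ suc) + h 0            ≡⟨ +-comm _ (h 0) ⟩
    ∑ (suc p) h                    ≡⟨ ∑-init-last p h ⟩
    ∑ p h + h p                    ≡⟨ cong (∑ p h +_) (trans (periodic s) (cong g (sym (+-identityʳ s)))) ⟩
    ∑ p h + h 0                    ∎)
    where open ≡-Reasoning

∑-periodic : ∀ p (g : ℕ → ℕ) → (∀ x → g (x + p) ≡ g x) → ∀ s q → ∑[ t < q * p ] g (s + t) ≡ q * ∑ p g
∑-periodic p g periodic s zero    = refl
∑-periodic p g periodic s (suc q) = begin
  ∑[ t < p + q * p ] g (s + t)                          ≡⟨ ∑-+ p (q * p) (λ t → g (s + t)) ⟩
  ∑[ t < p ] g (s + t) + ∑[ t < q * p ] g (s + (p + t)) ≡⟨ cong₂ _+_ (∑-shift p g periodic s) (∑-cong (q * p) shift) ⟩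
  ∑ p g + ∑[ t < q * p ] g (s + t)                      ≡⟨ cong (∑ p g +_) (∑-periodic p g periodic s q) ⟩
  ∑ p g + q * ∑ p g                                     ∎
  where
  open ≡-Reasoning
  shift : ∀ t → t < q * p → g (s + (p + t)) ≡ g (s + t)
  shift t _ = trans (cong g (trans (cong (s +_) (+-comm p t)) (sym (+-assoc s t p)))) (periodic (s + t))

∑-indicator : ∀ n c → c < n → ∑[ j < n ] 𝟙 (j ≡ᵇ c) ≡ 1
∑-indicator (suc n) zero    _         = cong suc (trans (∑-const n 0) (*-zeroʳ n))
∑-indicator (suc n) (suc c) (s≤s c<n) = ∑-indicator n c c<n

∑-multiples : ∀ μ ⦃ _ : NonZero μ ⦄ s q → ∑[ t < q * μ ] 𝟙 ((s + t) % μ ≡ᵇ 0) ≡ q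
∑-multiples μ s q = begin
  ∑[ t < q * μ ] isMultiple (s + t) ≡⟨ ∑-periodic μ isMultiple periodic s q ⟩
  q * ∑ μ isMultiple               ≡⟨ cong (q *_) (trans (∑-cong μ below) (∑-indicator μ 0 (>-nonZero⁻¹ μ))) ⟩
  q * 1                            ≡⟨ *-identityʳ q ⟩
  q                                ∎
  where
  open ≡-Reasoning
  isMultiple : ℕ → ℕ
  isMultiple x = 𝟙 (x % μ ≡ᵇ 0)
  periodic : ∀ x → isMultiple (x + μ) ≡ isMultiple x
  periodic x = cong (λ r → 𝟙 (r ≡ᵇ 0)) ([m+n]%n≡m%n x μ)
  below : ∀ t → t < μ → isMultiple t ≡ 𝟙 (t ≡ᵇ 0)
  below t t<μ = cong (λ r → 𝟙 (r ≡ᵇ 0)) (m<n⇒m%n≡m t<μ)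

≡ᵇ-comm : ∀ a b → (a ≡ᵇ b) ≡ (b ≡ᵇ a)
≡ᵇ-comm zero    zero    = refl
≡ᵇ-comm zero    (suc b) = refl
≡ᵇ-comm (suc a) zero    = refl
≡ᵇ-comm (suc a) (suc b) = ≡ᵇ-comm a b

𝟙-∧ : ∀ a b → 𝟙 (a ∧ b) ≡ 𝟙 a * 𝟙 b
𝟙-∧ true  b = sym (+-identityʳ (𝟙 b))
𝟙-∧ false b = refl

𝟙-∨-≤ : ∀ a b → 𝟙 (a ∨ b) ≤ 𝟙 a + 𝟙 b
𝟙-∨-≤ true  b = s≤s z≤n
𝟙-∨-≤ false b = ≤-refl

𝟙-T : ∀ {a} → T a → 𝟙 a ≡ 1
𝟙-T {true} _ = refl

𝟙-any-applyUpTo-≤ : ∀ (p : ℕ → Bool) f k → 𝟙 (any p (applyUpTo f k)) ≤ ∑[ l < k ] 𝟙 (p (f l))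
𝟙-any-applyUpTo-≤ p f zero    = z≤n
𝟙-any-applyUpTo-≤ p f (suc k) =
  ≤-trans (𝟙-∨-≤ (p (f 0)) _) (+-monoʳ-≤ (𝟙 (p (f 0))) (𝟙-any-applyUpTo-≤ p (f ∘ suc) k))

∣S∣≡∑ : ∀ {n} (S : Subset n) (g : ℕ → ℕ) → (∀ i → 𝟙 (lookup S i) ≡ g (toℕ i)) → ∣ S ∣ ≡ ∑ n g
∣S∣≡∑ []          g eq = refl
∣S∣≡∑ (true ∷ S)  g eq = cong₂ _+_ (eq fzero) (∣S∣≡∑ S (g ∘ suc) (eq ∘ fsuc))
∣S∣≡∑ (false ∷ S) g eq = cong₂ _+_ (eq fzero) (∣S∣≡∑ S (g ∘ suc) (eq ∘ fsuc))

window-split : ∀ m t → t < suc (2 * m) →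
  t ≡ m ⊎ ∃[ l ] (l < m × t ≡ m + suc l) ⊎ ∃[ l ] (l < m × t + suc l ≡ m)
window-split m t t<M with <-cmp t m
... | tri≈ _ t≡m _ = inj₁ t≡m
... | tri> _ _ m<t = inj₂ (inj₁ (t ∸ suc m , l<m , sym m+1+l≡t))
  where
  m+1+l≡t : m + suc (t ∸ suc m) ≡ t
  m+1+l≡t = trans (+-suc m _) (m+[n∸m]≡n m<t)
  l<m : t ∸ suc m < m
  l<m = +-cancelˡ-< (suc m) _ _ (subst (_< suc m + m) (sym (m+[n∸m]≡n m<t))
          (subst (t <_) (cong suc (cong (m +_) (+-identityʳ m))) t<M))
... | tri< t<m _ _ = inj₂ (inj₂ (m ∸ suc t , ∸-monoʳ-< z<s t<m , trans (+-suc t _) (m+[n∸m]≡n t<m)))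

m*[o/n]≤o*p⇒m/n≤p : ∀ m n o p ⦃ _ : NonZero n ⦄ ⦃ _ : NonZero o ⦄ → n ∣ m → n ∣ o →
  m * (o / n) ≤ o * p → m / n ≤ p
m*[o/n]≤o*p⇒m/n≤p m n o p n∣m n∣o le = *-cancelʳ-≤ (m / n) p o (begin
  m / n * o             ≡⟨ cong (m / n *_) (sym (m*[n/m]≡n n∣o)) ⟩
  m / n * (n * (o / n)) ≡⟨ sym (*-assoc (m / n) n (o / n)) ⟩
  m / n * n * (o / n)   ≡⟨ cong (_* (o / n)) (m/n*n≡m n∣m) ⟩
  m * (o / n)           ≤⟨ le ⟩
  o * p                 ≡⟨ *-comm o p ⟩
  p * o                 ∎)
  where open ≤-Reasoning

module Residues (n : ℕ) where

  N : ℕ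
  N = suc n

  fin : ℕ → Fin N
  fin x = fromℕ< (m%n<n x N)

  toℕ-fin : ∀ x → toℕ (fin x) ≡ x % N
  toℕ-fin x = toℕ-fromℕ< (m%n<n x N)

  fin-toℕ : ∀ i → fin (toℕ i) ≡ i
  fin-toℕ i = toℕ-injective (trans (toℕ-fin (toℕ i)) (m<n⇒m%n≡m (toℕ<n i)))

  fin-periodic : ∀ x → fin (x + N) ≡ fin x
  fin-periodic x = toℕ-injective (trans (toℕ-fin (x + N)) (trans ([m+n]%n≡m%n x N) (sym (toℕ-fin x))))

  [a%N+b]%N≡[a+b]%N : ∀ a b → (a % N + b) % N ≡ (a + b) % N
  [a%N+b]%N≡[a+b]%N a b = begin
    (a % N + b) % N           ≡⟨ %-distribˡ-+ (a % N) b N ⟩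
    (a % N % N + b % N) % N   ≡⟨ cong (λ r → (r + b % N) % N) (m%n%n≡m%n a N) ⟩
    (a % N + b % N) % N       ≡⟨ %-distribˡ-+ a b N ⟨
    (a + b) % N               ∎
    where open ≡-Reasoning

  toℕ-fin%N≡x%N : ∀ x → toℕ (fin x) % N ≡ x % N
  toℕ-fin%N≡x%N x = trans (cong (_% N) (toℕ-fin x)) (m%n%n≡m%n x N)

  [toℕ-fin+b]%N≡[x+b]%N : ∀ x b → (toℕ (fin x) + b) % N ≡ (x + b) % N
  [toℕ-fin+b]%N≡[x+b]%N x b = trans (cong (λ r → (r + b) % N) (toℕ-fin x)) ([a%N+b]%N≡[a+b]%N x b)

  hits : ℕ → ℕ → ℕ → ℕ
  hits c a x = 𝟙 ((x + c) % N ≡ᵇ a)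

  ∑-hits : ∀ c a → a < N → ∑[ x < N ] hits c a x ≡ 1
  ∑-hits c a a<N = begin
    ∑[ x < N ] residueIs (x + c) ≡⟨ ∑-cong N (λ x _ → cong residueIs (+-comm x c)) ⟩
    ∑[ x < N ] residueIs (c + x) ≡⟨ ∑-shift N residueIs periodic c ⟩
    ∑ N residueIs                ≡⟨ ∑-cong N (λ x x<N → cong (λ r → 𝟙 (r ≡ᵇ a)) (m<n⇒m%n≡m x<N)) ⟩
    ∑[ x < N ] 𝟙 (x ≡ᵇ a)        ≡⟨ ∑-indicator N a a<N ⟩
    1                            ∎
    where
    open ≡-Reasoning
    residueIs : ℕ → ℕ
    residueIs y = 𝟙 (y % N ≡ᵇ a)
    periodic : ∀ y → residueIs (y + N) ≡ residueIs y
    periodic y = cong (λ r → 𝟙 (r ≡ᵇ a)) ([m+n]%n≡m%n y N)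

  χ : Subset N → ℕ → ℕ
  χ S x = 𝟙 (lookup S (fin x))

  ∣S∣≡∑χ : ∀ S → ∣ S ∣ ≡ ∑[ x < N ] χ S x
  ∣S∣≡∑χ S = ∣S∣≡∑ S (χ S) (λ i → cong (𝟙 ∘ lookup S) (sym (fin-toℕ i)))

  χ-∩ : ∀ S R x → χ (S ∩ R) x ≡ χ S x * χ R x
  χ-∩ S R x = trans (cong 𝟙 (lookup-zipWith _∧_ (fin x) S R)) (𝟙-∧ (lookup S (fin x)) (lookup R (fin x)))

  χ-periodic : ∀ S x → χ S (x + N) ≡ χ S x
  χ-periodic S x = cong (𝟙 ∘ lookup S) (fin-periodic x)

  multiples : (μ : ℕ) ⦃ _ : NonZero μ ⦄ → Subset N
  multiples μ = tabulate (λ i → toℕ i % μ ≡ᵇ 0)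

  χ-multiples : ∀ μ ⦃ _ : NonZero μ ⦄ → μ ∣ N → ∀ x → χ (multiples μ) x ≡ 𝟙 (x % μ ≡ᵇ 0)
  χ-multiples μ μ∣N x = cong 𝟙 (trans (lookup∘tabulate (λ i → toℕ i % μ ≡ᵇ 0) (fin x))
    (cong (_≡ᵇ 0) (trans (cong (_% μ) (toℕ-fin x)) (m∣n⇒o%n%m≡o%m μ N x μ∣N))))

  ∣multiples∣ : ∀ μ ⦃ _ : NonZero μ ⦄ → μ ∣ N → ∣ multiples μ ∣ ≡ N / μ
  ∣multiples∣ μ μ∣N = begin
    ∣ multiples μ ∣                         ≡⟨ ∣S∣≡∑χ (multiples μ) ⟩
    ∑[ x < N ] χ (multiples μ) x            ≡⟨ ∑-cong N (λ x _ → χ-multiples μ μ∣N x) ⟩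
    ∑[ x < N ] 𝟙 (x % μ ≡ᵇ 0)               ≡⟨ cong (λ k → ∑[ x < k ] 𝟙 (x % μ ≡ᵇ 0)) (m/n*n≡m μ∣N) ⟨
    ∑[ x < N / μ * μ ] 𝟙 ((0 + x) % μ ≡ᵇ 0) ≡⟨ ∑-multiples μ 0 (N / μ) ⟩
    N / μ                                   ∎
    where open ≡-Reasoning

module WebGraph (n m : ℕ) where

  open Residues n

  M : ℕ
  M = suc (2 * m)

  lookup-closedNbhd : ∀ v w → lookup (closedNbhd N m v) w ≡ (toℕ v ≡ᵇ toℕ w) ∨ webAdjᵇ N m v w
  lookup-closedNbhd v w = lookup∘tabulate (λ u → (toℕ v ≡ᵇ toℕ u) ∨ webAdjᵇ N m v u) w

  𝟙-closedNbhd-≤ : ∀ x w → 𝟙 (lookup (closedNbhd N m (fin x)) w) ≤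
    hits 0 (toℕ w) x + ∑[ l < m ] (hits (suc l) (toℕ w % N) x + hits 0 ((toℕ w + suc l) % N) x)
  𝟙-closedNbhd-≤ x w = begin
    𝟙 (lookup (closedNbhd N m v) w)                   ≡⟨ cong 𝟙 (lookup-closedNbhd v w) ⟩
    𝟙 ((toℕ v ≡ᵇ toℕ w) ∨ any P (map suc (upTo m)))   ≤⟨ 𝟙-∨-≤ (toℕ v ≡ᵇ toℕ w) _ ⟩
    𝟙 (toℕ v ≡ᵇ toℕ w) + 𝟙 (any P (map suc (upTo m))) ≡⟨ cong₂ _+_ centre (cong (𝟙 ∘ any P) (map-upTo suc m)) ⟩
    hits 0 (toℕ w) x + 𝟙 (any P (applyUpTo suc m))    ≤⟨ +-monoʳ-≤ (hits 0 (toℕ w) x) (𝟙-any-applyUpTo-≤ P suc m) ⟩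
    hits 0 (toℕ w) x + ∑[ l < m ] 𝟙 (P (suc l))       ≤⟨ +-monoʳ-≤ (hits 0 (toℕ w) x) (∑-mono-≤ m sides) ⟩
    hits 0 (toℕ w) x + ∑[ l < m ] (hits (suc l) (toℕ w % N) x + hits 0 ((toℕ w + suc l) % N) x) ∎
    where
    open ≤-Reasoning
    v : Fin N
    v = fin x
    P : ℕ → Bool
    P l = modEqᵇ N (toℕ w) (toℕ v + l) ∨ modEqᵇ N (toℕ w + l) (toℕ v)
    centre : 𝟙 (toℕ v ≡ᵇ toℕ w) ≡ hits 0 (toℕ w) x
    centre = cong (λ r → 𝟙 (r ≡ᵇ toℕ w)) (trans (toℕ-fin x) (cong (_% N) (sym (+-identityʳ x))))
    right : ∀ l → 𝟙 (modEqᵇ N (toℕ w) (toℕ v + suc l)) ≡ hits (suc l) (toℕ w % N) x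
    right l = cong 𝟙 (trans (≡ᵇ-comm (toℕ w % N) ((toℕ v + suc l) % N))
                            (cong (_≡ᵇ toℕ w % N) ([toℕ-fin+b]%N≡[x+b]%N x (suc l))))
    left : ∀ l → 𝟙 (modEqᵇ N (toℕ w + suc l) (toℕ v)) ≡ hits 0 ((toℕ w + suc l) % N) x
    left l = cong 𝟙 (trans (≡ᵇ-comm ((toℕ w + suc l) % N) (toℕ v % N))
                           (cong (_≡ᵇ (toℕ w + suc l) % N) (trans (toℕ-fin%N≡x%N x) (cong (_% N) (sym (+-identityʳ x))))))
    sides : ∀ l → 𝟙 (P (suc l)) ≤ hits (suc l) (toℕ w % N) x + hits 0 ((toℕ w + suc l) % N) x
    sides l = ≤-trans (𝟙-∨-≤ (modEqᵇ N (toℕ w) (toℕ v + suc l)) (modEqᵇ N (toℕ w + suc l) (toℕ v)))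
                      (≤-reflexive (cong₂ _+_ (right l) (left l)))

  ∑-closedNbhd∋-≤ : ∀ w → ∑[ x < N ] 𝟙 (lookup (closedNbhd N m (fin x)) w) ≤ M
  ∑-closedNbhd∋-≤ w = begin
    ∑[ x < N ] 𝟙 (lookup (closedNbhd N m (fin x)) w)         ≤⟨ ∑-mono-≤ N (λ x → 𝟙-closedNbhd-≤ x w) ⟩
    ∑[ x < N ] (centre x + ∑[ l < m ] (right l x + left l x)) ≡⟨ ∑-distrib-+ N centre (λ x → ∑[ l < m ] (right l x + left l x)) ⟩
    ∑ N centre + ∑[ x < N ] ∑[ l < m ] (right l x + left l x) ≡⟨ cong (∑ N centre +_) (∑-comm N m (λ x l → right l x + left l x)) ⟩
    ∑ N centre + ∑[ l < m ] ∑[ x < N ] (right l x + left l x) ≡⟨ cong (∑ N centre +_) (∑-cong m (λ l _ → ∑-distrib-+ N (right l) (left l))) ⟩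
    ∑ N centre + ∑[ l < m ] (∑ N (right l) + ∑ N (left l))    ≡⟨ cong₂ _+_ (∑-hits 0 (toℕ w) (toℕ<n w)) (∑-cong m (λ l _ → cong₂ _+_
                                                                   (∑-hits (suc l) (toℕ w % N) (m%n<n (toℕ w) N))
                                                                   (∑-hits 0 ((toℕ w + suc l) % N) (m%n<n (toℕ w + suc l) N)))) ⟩
    1 + ∑[ l < m ] 2                                          ≡⟨ cong suc (trans (∑-const m 2) (*-comm m 2)) ⟩
    M                                                         ∎
    where
    open ≤-Reasoning
    centre : ℕ → ℕ
    centre = hits 0 (toℕ w)
    right left : ℕ → ℕ → ℕ
    right l = hits (suc l) (toℕ w % N)
    left l = hits 0 ((toℕ w + suc l) % N)

  kTupleDominating⇒N*k≤M*∣D∣ : ∀ k D → IsKTupleDominating N m k D → N * k ≤ M * ∣ D ∣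
  kTupleDominating⇒N*k≤M*∣D∣ k D dominating = begin
    N * k                                                ≡⟨ ∑-const N k ⟨
    ∑[ x < N ] k                                         ≤⟨ ∑-mono-≤ N (dominating ∘ fin) ⟩
    ∑[ x < N ] ∣ closedNbhd N m (fin x) ∩ D ∣            ≡⟨ ∑-cong N (λ x _ → trans (∣S∣≡∑χ (closedNbhd N m (fin x) ∩ D)) (∑-cong N (λ y _ → χ-∩ (closedNbhd N m (fin x)) D y))) ⟩
    ∑[ x < N ] ∑[ y < N ] (nbhd x y * χ D y)             ≡⟨ ∑-comm N N (λ x y → nbhd x y * χ D y) ⟩
    ∑[ y < N ] ∑[ x < N ] (nbhd x y * χ D y)             ≡⟨ ∑-cong N (λ y _ → ∑-distribʳ-* N (λ x → nbhd x y) (χ D y)) ⟨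
    ∑[ y < N ] (∑[ x < N ] nbhd x y * χ D y)             ≤⟨ ∑-mono-≤ N (λ y → *-monoˡ-≤ (χ D y) (∑-closedNbhd∋-≤ (fin y))) ⟩
    ∑[ y < N ] (M * χ D y)                               ≡⟨ ∑-distribˡ-* N M (χ D) ⟨
    M * ∑ N (χ D)                                        ≡⟨ cong (M *_) (∣S∣≡∑χ D) ⟨
    M * ∣ D ∣                                            ∎
    where
    open ≤-Reasoning
    nbhd : ℕ → ℕ → ℕ
    nbhd x = χ (closedNbhd N m (fin x))

  webAdj-intro : ∀ v x {l} → l < m →
    x % N ≡ (toℕ v + suc l) % N ⊎ (x + suc l) % N ≡ toℕ v % N → T (webAdjᵇ N m v (fin x))
  webAdj-intro v x {l} l<m congruence = subst (T ∘ any P) (sym (map-upTo suc m))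
    (any⁺ P (lose (∈-applyUpTo⁺ suc l<m) (Equivalence.from T-∨ (Data.Sum.map
      (λ eq → ≡⇒≡ᵇ _ _ (trans (toℕ-fin%N≡x%N x) eq))
      (λ eq → ≡⇒≡ᵇ _ _ (trans ([toℕ-fin+b]%N≡[x+b]%N x (suc l)) eq))
      congruence))))
    where
    P : ℕ → Bool
    P l = modEqᵇ N (toℕ (fin x)) (toℕ v + l) ∨ modEqᵇ N (toℕ (fin x) + l) (toℕ v)

  -- N ∸ m + v is v − m modulo N, written so that the subtraction never truncates.
  window⊆closedNbhd : m ≤ N → ∀ v t → t < M → T (lookup (closedNbhd N m v) (fin (N ∸ m + toℕ v + t)))
  window⊆closedNbhd m≤N v t t<M = subst T (sym (lookup-closedNbhd v (fin (s + t)))) (member (window-split m t t<M))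
    where
    s : ℕ
    s = N ∸ m + toℕ v
    s+m≡N+v : s + m ≡ N + toℕ v
    s+m≡N+v = begin
      N ∸ m + toℕ v + m   ≡⟨ +-assoc (N ∸ m) (toℕ v) m ⟩
      N ∸ m + (toℕ v + m) ≡⟨ cong (N ∸ m +_) (+-comm (toℕ v) m) ⟩
      N ∸ m + (m + toℕ v) ≡⟨ +-assoc (N ∸ m) m (toℕ v) ⟨
      N ∸ m + m + toℕ v   ≡⟨ cong (_+ toℕ v) (m∸n+n≡m m≤N) ⟩
      N + toℕ v           ∎
      where open ≡-Reasoning
    N+-% : ∀ y → (N + y) % N ≡ y % N
    N+-% y = %-remove-+ˡ y (∣-refl {N})
    member : t ≡ m ⊎ ∃[ l ] (l < m × t ≡ m + suc l) ⊎ ∃[ l ] (l < m × t + suc l ≡ m) →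
      T ((toℕ v ≡ᵇ toℕ (fin (s + t))) ∨ webAdjᵇ N m v (fin (s + t)))
    member (inj₁ refl) = Equivalence.from T-∨ (inj₁ (≡⇒≡ᵇ _ _ (sym (begin
      toℕ (fin (s + m)) ≡⟨ toℕ-fin (s + m) ⟩
      (s + m) % N       ≡⟨ cong (_% N) s+m≡N+v ⟩
      (N + toℕ v) % N   ≡⟨ N+-% (toℕ v) ⟩
      toℕ v % N         ≡⟨ m<n⇒m%n≡m (toℕ<n v) ⟩
      toℕ v             ∎))))
      where open ≡-Reasoning
    member (inj₂ (inj₁ (l , l<m , refl))) = Equivalence.from T-∨ (inj₂ (webAdj-intro v (s + t) l<m (inj₁ (begin
      (s + (m + suc l)) % N ≡⟨ cong (_% N) (trans (sym (+-assoc s m (suc l))) (cong (_+ suc l) s+m≡N+v)) ⟩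
      (N + toℕ v + suc l) % N ≡⟨ cong (_% N) (+-assoc N (toℕ v) (suc l)) ⟩
      (N + (toℕ v + suc l)) % N ≡⟨ N+-% (toℕ v + suc l) ⟩
      (toℕ v + suc l) % N     ∎))))
      where open ≡-Reasoning
    member (inj₂ (inj₂ (l , l<m , t+l≡m))) = Equivalence.from T-∨ (inj₂ (webAdj-intro v (s + t) l<m (inj₂ (begin
      (s + t + suc l) % N ≡⟨ cong (_% N) (trans (+-assoc s t (suc l)) (cong (s +_) t+l≡m)) ⟩
      (s + m) % N         ≡⟨ cong (_% N) s+m≡N+v ⟩
      (N + toℕ v) % N     ≡⟨ N+-% (toℕ v) ⟩
      toℕ v % N           ∎))))
      where open ≡-Reasoning

  ∑-window-≤-∣closedNbhd∩∣ : M ≤ N → ∀ v S → ∑[ t < M ] χ S (N ∸ m + toℕ v + t) ≤ ∣ closedNbhd N m v ∩ S ∣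
  ∑-window-≤-∣closedNbhd∩∣ M≤N v S = begin
    ∑[ t < M ] χ S (s + t)                                  ≡⟨ ∑-cong M inWindow ⟩
    ∑[ t < M ] h (s + t)                                    ≤⟨ m≤m+n _ _ ⟩
    ∑[ t < M ] h (s + t) + ∑[ t < N ∸ M ] h (s + (M + t))   ≡⟨ ∑-+ M (N ∸ M) (λ t → h (s + t)) ⟨
    ∑[ t < M + (N ∸ M) ] h (s + t)                          ≡⟨ cong (λ k → ∑[ t < k ] h (s + t)) (m+[n∸m]≡n M≤N) ⟩
    ∑[ t < N ] h (s + t)                                    ≡⟨ ∑-shift N h (χ-periodic (closedNbhd N m v ∩ S)) s ⟩
    ∑ N h                                                   ≡⟨ ∣S∣≡∑χ (closedNbhd N m v ∩ S) ⟨
    ∣ closedNbhd N m v ∩ S ∣                                ∎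
    where
    open ≤-Reasoning
    s : ℕ
    s = N ∸ m + toℕ v
    h : ℕ → ℕ
    h = χ (closedNbhd N m v ∩ S)
    inWindow : ∀ t → t < M → χ S (s + t) ≡ h (s + t)
    inWindow t t<M = sym (begin-equality
      h (s + t)                                   ≡⟨ χ-∩ (closedNbhd N m v) S (s + t) ⟩
      χ (closedNbhd N m v) (s + t) * χ S (s + t)  ≡⟨ cong (_* χ S (s + t)) (𝟙-T (window⊆closedNbhd m≤N v t t<M)) ⟩
      1 * χ S (s + t)                             ≡⟨ *-identityˡ (χ S (s + t)) ⟩
      χ S (s + t)                                 ∎)
      where
      m≤N : m ≤ N
      m≤N = ≤-trans (m≤m+n m (m + 0)) (≤-trans (n≤1+n _) M≤N)

  multiples-kTupleDominating : ∀ μ ⦃ _ : NonZero μ ⦄ → μ ∣ N → μ ∣ M → M ≤ N →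
    IsKTupleDominating N m (M / μ) (multiples μ)
  multiples-kTupleDominating μ μ∣N μ∣M M≤N v = begin
    M / μ                                          ≡⟨ ∑-multiples μ s (M / μ) ⟨
    ∑[ t < M / μ * μ ] 𝟙 ((s + t) % μ ≡ᵇ 0)        ≡⟨ cong (λ k → ∑[ t < k ] 𝟙 ((s + t) % μ ≡ᵇ 0)) (m/n*n≡m μ∣M) ⟩
    ∑[ t < M ] 𝟙 ((s + t) % μ ≡ᵇ 0)                ≡⟨ ∑-cong M (λ t _ → χ-multiples μ μ∣N (s + t)) ⟨
    ∑[ t < M ] χ (multiples μ) (s + t)             ≤⟨ ∑-window-≤-∣closedNbhd∩∣ M≤N v (multiples μ) ⟩
    ∣ closedNbhd N m v ∩ multiples μ ∣             ∎
    where
    open ≤-Reasoning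
    s : ℕ
    s = N ∸ m + toℕ v

-- The argument also covers m = 0.
proposition6p2 : (m n : ℕ) → 1 ≤ m → suc (2 * m) ≤ n →
    KTupleDominationNumberIs n m (l₂ n m) (_/_ n (μ n m) {{μ-nonZero n m}})
proposition6p2 m zero    _ ()
proposition6p2 m (suc n) _ M≤N =
    (multiples μ' , multiples-kTupleDominating μ' μ∣N μ∣M M≤N , ∣multiples∣ μ' μ∣N)
  , λ D dominating → m*[o/n]≤o*p⇒m/n≤p N μ' M ∣ D ∣ μ∣N μ∣M (kTupleDominating⇒N*k≤M*∣D∣ (M / μ') D dominating)
  where
  open Residues n
  open WebGraph n m
  μ' : ℕ
  μ' = μ N m
  instance
    μ'-nonZero : NonZero μ'
    μ'-nonZero = μ-nonZero N m
  μ∣M : μ' ∣ M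
  μ∣M = gcd[m,n]∣m M (N % M)
  μ∣N : μ' ∣ N
  μ∣N = ∣n∣m%n⇒∣m μ∣M (gcd[m,n]∣n M (N % M))
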